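{- Let $d\ge 1$ and $n\ge 1$ be integers. For any nonnegative integers $k$ and $\ell$, the total number of pairs $(T,v)$, where $T$ is a rooted $d$-tuplet tree with $n$ tuplets and $v$ is a vertex of $T$ of outdegree exactly $k$ at level exactly $\ell$, equals $$d^{\ell}\,\frac{dk+(d+1)\ell}{(d+1)n-k}\binom{(d+1)n-k}{dn+\ell}.$$
   Context: A rooted $d$-tuplet tree is the following recursively defined ordered structure. It has a distinguished vertex, the root. Each vertex $u$ has a (possibly empty) linearly ordered list of tuplets attached below it. Each tuplet attached at $u$ consists of $u$ together with a linearly ordered list of exactly $d$ new vertices, each of which is again the top of such a structure. Equivalently, it is a rooted plane tree in which the children of every vertex are grouped, left to right, into consecutive blocks of size $d$. The number of tuplets is the total number of such blocks. The outdegree of a vertex $v$ is the number of tuplets attached below $v$. The level of $v$ is the number of tuplets on the path from the root to $v$. -}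

module Defs where

open import Data.Nat using (ℕ; zero; suc; _+_)
open import Data.List using (List; []; _∷_; length)
import Data.List as L
open import Data.Vec using (Vec; []; _∷_)
import Data.Vec as V
open import Data.Fin using (Fin)
open import Data.Product using (Σ; _×_)
open import Relation.Binary.PropositionalEquality using (_≡_)

-- A rooted d-tuplet tree: a vertex with a linearly ordered list of tuplets
-- below it, each tuplet being an ordered d-vector of subtrees.
data Tree (d : ℕ) : Set where
  node : List (Vec (Tree d) d) → Tree d

mutual
  tuplets : ∀ {d} → Tree d → ℕ
  tuplets (node ts) = length ts + tupletsL ts

  tupletsL : ∀ {d} → List (Vec (Tree d) d) → ℕ
  tupletsL [] = 0
  tupletsL (t ∷ ts) = tupletsV t + tupletsL ts

  tupletsV : ∀ {d n} → Vec (Tree d) n → ℕ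
  tupletsV [] = 0
  tupletsV (t ∷ ts) = tuplets t + tupletsV ts

data Vertex {d : ℕ} : Tree d → Set where
  root  : ∀ {ts} → Vertex (node ts)
  below : ∀ {ts} (i : Fin (length ts)) (j : Fin d) →
          Vertex (V.lookup (L.lookup ts i) j) → Vertex (node ts)

outdeg : ∀ {d} {T : Tree d} → Vertex T → ℕ
outdeg {T = node ts} root = length ts
outdeg (below i j v) = outdeg v

level : ∀ {d} {T : Tree d} → Vertex T → ℕ
level root = 0
level (below i j v) = suc (level v)

Pairs : (d n k ℓ : ℕ) → Set
Pairs d n k ℓ =
  Σ (Tree d) λ T → tuplets T ≡ n × Σ (Vertex T) λ v → outdeg v ≡ k × level v ≡ ℓ

-- The objects are counted through bijections that remove one tuplet at a time while keeping
-- track of (tuplets, outdegree, level). A sequence of r trees with m tuplets either starts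
-- with a bare vertex, or comes from a sequence of d + r + 1 trees with m − 1 tuplets by
-- grafting its first d trees as a new first tuplet onto the next one. A marked vertex is
-- either the root of the first tree, whose k tuplets can be moved into the sequence, or it
-- lies in the j-th tree of some tuplet at that root: cutting this tuplet out, the tuplets
-- before and after it become two new trees and the d − 1 siblings join the sequence. This
-- gives recurrences in which the marked vertex rises one level at the cost of a factor d,
-- down to a shifted forest count r/((d+1)m+r)·C((d+1)m+r, m), which follows from Pascal's
-- rule. The closed form, generalised to r extra trees, satisfies the same recurrences.

module Submission where

open import Defs
open import Data.Nat using (ℕ; zero; suc; _+_; _*_; _∸_; _^_; _≤_; _<_; z≤n; s≤s; >-nonZero)
open import Data.Nat.Properties
  using ( +-assoc; +-identityʳ; *-assoc; *-identityʳ; *-identityˡ; *-zeroʳ; *-cancelˡ-≡; +-cancelʳ-≡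
        ; m≤m+n; m≤n+m; m+n∸m≡n; m∸n≤m; ≤-trans; ≤-<-trans; m<m+n; m≤m*n
        ; suc-injective; ≡-irrelevant; _≟_)
open import Data.Nat.Combinatorics using (_C_; nCk+nC[k+1]≡[n+1]C[k+1]; nCk≡nC[n∸k]; k>n⇒nCk≡0; nC1≡n)
open import Data.Nat.Tactic.RingSolver using (solve-∀)
open import Data.Fin using (Fin; zero; suc)
open import Data.Fin.Properties using (+↔⊎; *↔×)
open import Data.List using (List; []; _∷_; length)
import Data.List as List
open import Data.List.Properties using (length-++)
open import Data.Vec using (Vec; []; _∷_; _++_; take; drop; insertAt)
import Data.Vec as Vec
open import Data.Vec.Properties using (take++drop≡id; ++-injective)
open import Data.Product using (Σ; _×_; _,_; proj₁; proj₂; map₁)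
import Data.Product.Properties as Product
open import Data.Product.Function.Dependent.Propositional using (Σ-↔)
open import Data.Product.Algebra using (×-cong)
open import Data.Sum using (_⊎_; inj₁; inj₂; [_,_])
open import Data.Sum.Algebra using (⊎-cong; ⊎-identityˡ; ⊎-identityʳ)
open import Data.Empty using (⊥-elim)
open import Data.Empty.Polymorphic using (⊥)
open import Function.Base using (_∘_)
open import Function.Bundles using (_↔_; Inverse; mk↔ₛ′)
open import Function.Definitions using (Injective)
open import Function.Properties.Inverse using (↔-refl; ↔-sym; ↔-trans)
open import Function.Related.TypeIsomorphisms using (Σ-assoc; Σ-distribʳ-⊎)
open import Axiom.UniquenessOfIdentityProofs using (UIP; module Decidable⇒UIP)
open import Relation.Nullary using (¬_)
open import Relation.Binary.PropositionalEquality
  using (_≡_; _≢_; refl; sym; trans; cong; cong₂; subst; module ≡-Reasoning)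

↔-empty : {A B : Set} → ¬ A → ¬ B → A ↔ B
↔-empty ¬a ¬b = mk↔ₛ′ (⊥-elim ∘ ¬a) (⊥-elim ∘ ¬b) (⊥-elim ∘ ¬b) (⊥-elim ∘ ¬a)

≡-congˡ-↔ : {A : Set} {x y z : A} → x ≡ y → (x ≡ z) ↔ (y ≡ z)
≡-congˡ-↔ refl = ↔-refl

injective-≡-↔ : {A B : Set} {h : A → B} → UIP A → UIP B → Injective _≡_ _≡_ h →
                ∀ {x y} → (h x ≡ h y) ↔ (x ≡ y)
injective-≡-↔ {h = h} uipA uipB h-inj = mk↔ₛ′ h-inj (cong h) (λ _ → uipA _ _) (λ _ → uipB _ _)

Fibre : {A S : Set} → (A → S) → S → Set
Fibre {A} f s = Σ A λ a → f a ≡ s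

module _ {A S : Set} {f : A → S} {s : S} where

  fibre-↔ : {B : Set} {g : B → S} (e : A ↔ B) → (∀ a → f a ≡ g (Inverse.to e a)) →
            Fibre f s ↔ Fibre g s
  fibre-↔ e f≡g∘e = Σ-↔ e (≡-congˡ-↔ (f≡g∘e _))

  fibre-⊎ : {B : Set} {g : B → S} → Fibre [ f , g ] s ↔ (Fibre f s ⊎ Fibre g s)
  fibre-⊎ = Σ-distribʳ-⊎

  fibre-empty : (∀ a → f a ≢ s) → Fibre f s ↔ ⊥
  fibre-empty f≢s = ↔-empty (λ (a , fa≡s) → f≢s a fa≡s) (λ ())

  fibre-× : {C : Set} → Fibre (f ∘ proj₂ {A = C}) s ↔ (C × Fibre f s)
  fibre-× = Σ-assoc

  fibre-injective : {T : Set} {h : S → T} → UIP S → UIP T → Injective _≡_ _≡_ h →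
                    Fibre (h ∘ f) (h s) ↔ Fibre f s
  fibre-injective uipS uipT h-inj = Σ-↔ ↔-refl (injective-≡-↔ uipS uipT h-inj)

take-drop-++ : {A : Set} {m n : ℕ} (xs : Vec A m) (ys : Vec A n) →
               (take m (xs ++ ys) , drop m (xs ++ ys)) ≡ (xs , ys)
take-drop-++ {m = m} xs ys =
  let take≡xs , drop≡ys = ++-injective (take m (xs ++ ys)) xs (take++drop≡id m (xs ++ ys))
  in cong₂ _,_ take≡xs drop≡ys

module Focus {X : Set} (P : X → Set) where

  ListFocus : Set
  ListFocus = Σ (List X) λ xs → Σ (Fin (length xs)) λ i → P (List.lookup xs i)

  VecFocus : ℕ → Set
  VecFocus n = Σ (Vec X (suc n)) λ xs → Σ (Fin (suc n)) λ j → P (Vec.lookup xs j)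

  private
    consˡ : X → ListFocus → ListFocus
    consˡ x (xs , i , p) = x ∷ xs , suc i , p

    consᵛ : ∀ {n} → X → VecFocus n → VecFocus (suc n)
    consᵛ x (xs , j , p) = x ∷ xs , suc j , p

  plugList : List X × List X × Σ X P → ListFocus
  plugList ([]     , as , (x , p)) = x ∷ as , zero , p
  plugList (b ∷ bs , as , xp)      = consˡ b (plugList (bs , as , xp))

  unplugList : ListFocus → List X × List X × Σ X P
  unplugList (x ∷ xs , zero  , p) = [] , xs , (x , p)
  unplugList (x ∷ xs , suc i , p) = map₁ (x ∷_) (unplugList (xs , i , p))

  plugList-↔ : (List X × List X × Σ X P) ↔ ListFocus
  plugList-↔ = mk↔ₛ′ plugList unplugList plug∘unplug unplug∘plug
    where
    plug∘unplug : ∀ z → plugList (unplugList z) ≡ z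
    plug∘unplug (x ∷ xs , zero  , p) = refl
    plug∘unplug (x ∷ xs , suc i , p) = cong (consˡ x) (plug∘unplug (xs , i , p))
    unplug∘plug : ∀ w → unplugList (plugList w) ≡ w
    unplug∘plug ([]     , as , (x , p)) = refl
    unplug∘plug (b ∷ bs , as , xp)      = cong (map₁ (b ∷_)) (unplug∘plug (bs , as , xp))

  plugList-list : ∀ bs as x (p : P x) → proj₁ (plugList (bs , as , (x , p))) ≡ bs List.++ x ∷ as
  plugList-list []       as x p = refl
  plugList-list (b ∷ bs) as x p = cong (b ∷_) (plugList-list bs as x p)

  plugList-focus : {S : Set} (φ : ∀ {x} → P x → S) → ∀ bs as x (p : P x) →
                   φ (proj₂ (proj₂ (plugList (bs , as , (x , p))))) ≡ φ p
  plugList-focus φ []       as x p = refl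
  plugList-focus φ (b ∷ bs) as x p = plugList-focus φ bs as x p

  plugVec : ∀ {n} → Fin (suc n) × Vec X n × Σ X P → VecFocus n
  plugVec (zero  , xs     , (x , p)) = x ∷ xs , zero , p
  plugVec (suc j , y ∷ xs , xp)      = consᵛ y (plugVec (j , xs , xp))

  unplugVec : ∀ {n} → VecFocus n → Fin (suc n) × Vec X n × Σ X P
  unplugVec (x ∷ xs , zero , p) = zero , xs , (x , p)
  unplugVec {suc n} (x ∷ xs , suc j , p) = let j′ , ys , xp = unplugVec (xs , j , p) in suc j′ , x ∷ ys , xp

  plugVec-↔ : ∀ {n} → (Fin (suc n) × Vec X n × Σ X P) ↔ VecFocus n
  plugVec-↔ = mk↔ₛ′ plugVec unplugVec plug∘unplug unplug∘plug
    where
    plug∘unplug : ∀ {n} (z : VecFocus n) → plugVec (unplugVec z) ≡ z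
    plug∘unplug (x ∷ xs , zero , p) = refl
    plug∘unplug {suc n} (x ∷ xs , suc j , p) = cong (consᵛ x) (plug∘unplug (xs , j , p))
    unplug∘plug : ∀ {n} (w : Fin (suc n) × Vec X n × Σ X P) → unplugVec (plugVec w) ≡ w
    unplug∘plug (zero  , xs     , xp) = refl
    unplug∘plug (suc j , y ∷ xs , xp) =
      cong (λ (j′ , ys , xp′) → suc j′ , y ∷ ys , xp′) (unplug∘plug (j , xs , xp))

  plugVec-vec : ∀ {n} (j : Fin (suc n)) xs x (p : P x) → proj₁ (plugVec (j , xs , (x , p))) ≡ insertAt xs j x
  plugVec-vec zero    xs       x p = refl
  plugVec-vec (suc j) (y ∷ xs) x p = cong (y ∷_) (plugVec-vec j xs x p)

  plugVec-focus : {S : Set} (φ : ∀ {x} → P x → S) → ∀ {n} (j : Fin (suc n)) xs x (p : P x) →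
                  φ (proj₂ (proj₂ (plugVec (j , xs , (x , p))))) ≡ φ p
  plugVec-focus φ zero    xs       x p = refl
  plugVec-focus φ (suc j) (y ∷ xs) x p = plugVec-focus φ j xs x p

[k+1]nC[k+1]+k[nCk]≡n[nCk] : ∀ n k → suc k * (n C suc k) + k * (n C k) ≡ n * (n C k)
[k+1]nC[k+1]+k[nCk]≡n[nCk] zero    zero    = refl
[k+1]nC[k+1]+k[nCk]≡n[nCk] zero    (suc k) = cong₂ _+_ (*-zeroʳ (2 + k)) (*-zeroʳ (1 + k))
[k+1]nC[k+1]+k[nCk]≡n[nCk] (suc n) zero    = begin
  1 * (suc n C 1) + 0 ≡⟨ +-identityʳ _ ⟩
  1 * (suc n C 1)     ≡⟨ *-identityˡ _ ⟩
  suc n C 1           ≡⟨ nC1≡n (suc n) ⟩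
  suc n               ≡⟨ *-identityʳ (suc n) ⟨
  suc n * 1           ∎
  where open ≡-Reasoning
[k+1]nC[k+1]+k[nCk]≡n[nCk] (suc n) (suc k) = begin
  (2 + k) * (suc n C (2 + k)) + (1 + k) * (suc n C (1 + k))
    ≡⟨ cong₂ (λ x y → (2 + k) * x + (1 + k) * y)
             (nCk+nC[k+1]≡[n+1]C[k+1] n (suc k)) (nCk+nC[k+1]≡[n+1]C[k+1] n k) ⟨
  (2 + k) * (b + c) + (1 + k) * (a + b)
    ≡⟨ regroup k a b c ⟩
  ((2 + k) * c + (1 + k) * b) + ((1 + k) * b + k * a) + (b + a)
    ≡⟨ cong₂ (λ x y → x + y + (b + a))
             ([k+1]nC[k+1]+k[nCk]≡n[nCk] n (suc k)) ([k+1]nC[k+1]+k[nCk]≡n[nCk] n k) ⟩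
  n * b + n * a + (b + a)
    ≡⟨ collect n a b ⟩
  suc n * (a + b)
    ≡⟨ cong (suc n *_) (nCk+nC[k+1]≡[n+1]C[k+1] n k) ⟩
  suc n * (suc n C suc k) ∎
  where
  open ≡-Reasoning
  a b c : ℕ
  a = n C k
  b = n C suc k
  c = n C suc (suc k)
  regroup : ∀ k a b c → (2 + k) * (b + c) + (1 + k) * (a + b) ≡
                        ((2 + k) * c + (1 + k) * b) + ((1 + k) * b + k * a) + (b + a)
  regroup = solve-∀
  collect : ∀ n a b → n * b + n * a + (b + a) ≡ suc n * (a + b)
  collect = solve-∀

module Counts (d : ℕ) where

  forests : ℕ → ℕ → ℕ
  forests r       zero    = 1
  forests zero    (suc m) = 0
  forests (suc r) (suc m) = forests r (suc m) + forests (d + suc r) m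

  rooted : ℕ → ℕ → ℕ → ℕ
  rooted r m       zero    = forests r m
  rooted r zero    (suc k) = 0
  rooted r (suc m) (suc k) = rooted (d + r) m k

  pointed : ℕ → ℕ → ℕ → ℕ → ℕ
  pointed r m       k zero    = rooted r m k
  pointed r zero    k (suc ℓ) = 0
  pointed r (suc m) k (suc ℓ) = d * pointed (suc (d + r)) m k ℓ

  forests-closed-step : ∀ r m x y →
    x * (r + (d + 1) * suc m) ≡ r * ((r + (d + 1) * suc m) C suc m) →
    y * (d + suc r + (d + 1) * m) ≡ (d + suc r) * ((d + suc r + (d + 1) * m) C m) →
    (x + y) * (suc r + (d + 1) * suc m) ≡ suc r * ((suc r + (d + 1) * suc m) C suc m)
  forests-closed-step r m x y IH₁ IH₂′ = *-cancelˡ-≡ _ _ N {{>-nonZero N>0}} (begin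
    N * ((x + y) * suc N)             ≡⟨ distribute N x y ⟩
    suc N * (x * N + y * N)           ≡⟨ cong (suc N *_) (cong₂ _+_ IH₁ IH₂) ⟩
    suc N * (r * b + (d + suc r) * a) ≡⟨ +-cancelʳ-≡ _ _ _ absorbed ⟩
    N * (suc r * (a + b))             ≡⟨ cong (λ z → N * (suc r * z)) (nCk+nC[k+1]≡[n+1]C[k+1] N m) ⟩
    N * (suc r * (suc N C suc m))     ∎)
    where
    open ≡-Reasoning
    N a b : ℕ
    N = r + (d + 1) * suc m
    a = N C m
    b = N C suc m
    N>0 : 0 < N
    N>0 = ≤-trans (m≤n+m 1 d) (≤-trans (m≤m*n (d + 1) (suc m)) (m≤n+m _ r))
    IH₂ : y * N ≡ (d + suc r) * a
    IH₂ = subst (λ z → y * z ≡ (d + suc r) * (z C m)) (reindex d r m) IH₂′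
      where reindex : ∀ d r m → d + suc r + (d + 1) * m ≡ r + (d + 1) * suc m
            reindex = solve-∀
    distribute : ∀ N x y → N * ((x + y) * suc N) ≡ suc N * (x * N + y * N)
    distribute = solve-∀
    absorbed : suc N * (r * b + (d + suc r) * a) + (d + 1) * (N * a) ≡
               N * (suc r * (a + b)) + (d + 1) * (N * a)
    absorbed = begin
      suc N * (r * b + (d + suc r) * a) + (d + 1) * (N * a)
        ≡⟨ cong (λ z → suc N * (r * b + (d + suc r) * a) + (d + 1) * z) ([k+1]nC[k+1]+k[nCk]≡n[nCk] N m) ⟨
      suc N * (r * b + (d + suc r) * a) + (d + 1) * (suc m * b + m * a)
        ≡⟨ expand d m r a b ⟩
      N * (suc r * (a + b)) + (d + 1) * (N * a) ∎
      where
      expand : ∀ d m r a b → let N = r + (d + 1) * suc m in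
        suc N * (r * b + (d + suc r) * a) + (d + 1) * (suc m * b + m * a) ≡
        N * (suc r * (a + b)) + (d + 1) * (N * a)
      expand = solve-∀

  forests-closed : ∀ r m → forests r m * (r + (d + 1) * m) ≡ r * ((r + (d + 1) * m) C m)
  forests-closed r       zero    = unit d r
    where unit : ∀ d r → 1 * (r + (d + 1) * 0) ≡ r * 1
          unit = solve-∀
  forests-closed zero    (suc m) = refl
  forests-closed (suc r) (suc m) =
    forests-closed-step r m (forests r (suc m)) (forests (d + suc r) m)
      (forests-closed r (suc m)) (forests-closed (d + suc r) m)

  size : ℕ → ℕ → ℕ → ℕ
  size r m k = r + (d + 1) * m ∸ k

  -- The closed form of the statement for a marked tree followed by r further trees.
  formula : ℕ → ℕ → ℕ → ℕ → ℕ
  formula r m k ℓ = d ^ ℓ * (r + (d * k + (d + 1) * ℓ)) * (size r m k C (r + (d * m + ℓ)))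

  size-suc : ∀ r m k → size r (suc m) k ≡ size (suc (d + r)) m k
  size-suc r m k = cong (_∸ k) (shift d r m)
    where shift : ∀ d r m → r + (d + 1) * suc m ≡ suc (d + r) + (d + 1) * m
          shift = solve-∀

  -- For m = r = 0 and k > 0 nothing is counted, but the right-hand side is d · k.
  rooted-closed : 1 ≤ d → ∀ r m k → 1 ≤ m + r →
    rooted r m k * size r m k ≡ (r + d * k) * (size r m k C (r + d * m))
  rooted-closed _ r m zero _ = begin
    forests r m * N                  ≡⟨ forests-closed r m ⟩
    r * (N C m)                      ≡⟨ cong₂ _*_ (sym r+d*0≡r) (nCk≡nC[n∸k] m≤N) ⟩
    (r + d * 0) * (N C (N ∸ m))      ≡⟨ cong (λ i → (r + d * 0) * (N C i)) N∸m≡r+d*m ⟩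
    (r + d * 0) * (N C (r + d * m))  ∎
    where
    open ≡-Reasoning
    N : ℕ
    N = r + (d + 1) * m
    N≡m+[r+d*m] : N ≡ m + (r + d * m)
    N≡m+[r+d*m] = split d r m
      where split : ∀ d r m → r + (d + 1) * m ≡ m + (r + d * m)
            split = solve-∀
    m≤N : m ≤ N
    m≤N = subst (m ≤_) (sym N≡m+[r+d*m]) (m≤m+n m _)
    N∸m≡r+d*m : N ∸ m ≡ r + d * m
    N∸m≡r+d*m = trans (cong (_∸ m) N≡m+[r+d*m]) (m+n∸m≡n m _)
    r+d*0≡r : r + d * 0 ≡ r
    r+d*0≡r = trans (cong (r +_) (*-zeroʳ d)) (+-identityʳ r)
  rooted-closed _ (suc r) zero (suc k) _ =
    sym (trans (cong (w *_) vanishes) (*-zeroʳ w))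
    where
    w : ℕ
    w = suc r + d * suc k
    vanishes : size (suc r) 0 (suc k) C (suc r + d * 0) ≡ 0
    vanishes rewrite *-zeroʳ (d + 1) | *-zeroʳ d | +-identityʳ r = k>n⇒nCk≡0 (s≤s (m∸n≤m r k))
  rooted-closed d≥1 r (suc m) (suc k) _ = begin
    rooted (d + r) m k * size r (suc m) (suc k)
      ≡⟨ cong (rooted (d + r) m k *_) (size-suc r m (suc k)) ⟩
    rooted (d + r) m k * size (d + r) m k
      ≡⟨ rooted-closed d≥1 (d + r) m k (≤-trans d≥1 (≤-trans (m≤m+n d r) (m≤n+m (d + r) m))) ⟩
    (d + r + d * k) * (size (d + r) m k C (d + r + d * m))
      ≡⟨ cong₂ (λ w i → w * (size (d + r) m k C i)) (shift d r k) (shift d r m) ⟨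
    (r + d * suc k) * (size (d + r) m k C (r + d * suc m))
      ≡⟨ cong (λ n → (r + d * suc k) * (n C (r + d * suc m))) (size-suc r m (suc k)) ⟨
    (r + d * suc k) * (size r (suc m) (suc k) C (r + d * suc m)) ∎
    where
    open ≡-Reasoning
    shift : ∀ d r n → r + d * suc n ≡ d + r + d * n
    shift = solve-∀

  pointed-closed : 1 ≤ d → ∀ r m k ℓ → 1 ≤ m + r → pointed r m k ℓ * size r m k ≡ formula r m k ℓ
  pointed-closed d≥1 r m k zero 1≤m+r =
    trans (rooted-closed d≥1 r m k 1≤m+r)
          (cong₂ (λ w i → w * (size r m k C i)) (weight d r k) (cong (r +_) (sym (+-identityʳ (d * m)))))
    where
    weight : ∀ d r k → r + d * k ≡ 1 * (r + (d * k + (d + 1) * 0))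
    weight = solve-∀
  pointed-closed _ r zero k (suc ℓ) _ =
    sym (trans (cong (w *_) vanishes) (*-zeroʳ w))
    where
    w : ℕ
    w = d ^ suc ℓ * (r + (d * k + (d + 1) * suc ℓ))
    vanishes : size r 0 k C (r + (d * 0 + suc ℓ)) ≡ 0
    vanishes rewrite *-zeroʳ (d + 1) | *-zeroʳ d | +-identityʳ r =
      k>n⇒nCk≡0 (≤-<-trans (m∸n≤m r k) (m<m+n r (s≤s z≤n)))
  pointed-closed d≥1 r (suc m) k (suc ℓ) _ = begin
    d * Y * size r (suc m) k              ≡⟨ cong (d * Y *_) (size-suc r m k) ⟩
    d * Y * size (suc (d + r)) m k        ≡⟨ *-assoc d Y _ ⟩
    d * (Y * size (suc (d + r)) m k)      ≡⟨ cong (d *_) (pointed-closed d≥1 (suc (d + r)) m k ℓ 1≤m+[1+d+r]) ⟩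
    d * formula (suc (d + r)) m k ℓ       ≡⟨ regroup d (d ^ ℓ) _ _ ⟩
    d ^ suc ℓ * (suc (d + r) + (d * k + (d + 1) * ℓ)) * (size (suc (d + r)) m k C (suc (d + r) + (d * m + ℓ)))
      ≡⟨ cong₂ (λ w c → d ^ suc ℓ * w * c) (weight d r k ℓ) (cong₂ _C_ (size-suc r m k) (index d r m ℓ)) ⟨
    formula r (suc m) k (suc ℓ)           ∎
    where
    open ≡-Reasoning
    Y : ℕ
    Y = pointed (suc (d + r)) m k ℓ
    1≤m+[1+d+r] : 1 ≤ m + suc (d + r)
    1≤m+[1+d+r] = ≤-trans (s≤s z≤n) (m≤n+m (suc (d + r)) m)
    regroup : ∀ d p w c → d * (p * w * c) ≡ d * p * w * c
    regroup = solve-∀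
    weight : ∀ d r k ℓ → r + (d * k + (d + 1) * suc ℓ) ≡ suc (d + r) + (d * k + (d + 1) * ℓ)
    weight = solve-∀
    index : ∀ d r m ℓ → r + (d * suc m + suc ℓ) ≡ suc (d + r) + (d * m + ℓ)
    index = solve-∀

tupletsV-++ : ∀ {d m n} (xs : Vec (Tree d) m) (ys : Vec (Tree d) n) →
              tupletsV (xs ++ ys) ≡ tupletsV xs + tupletsV ys
tupletsV-++ []       ys = refl
tupletsV-++ (x ∷ xs) ys = trans (cong (tuplets x +_) (tupletsV-++ xs ys)) (sym (+-assoc (tuplets x) _ _))

tupletsV-insertAt : ∀ {d n} (xs : Vec (Tree d) n) j T → tupletsV (insertAt xs j T) ≡ tuplets T + tupletsV xs
tupletsV-insertAt xs       zero    T = refl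
tupletsV-insertAt (x ∷ xs) (suc j) T =
  trans (cong (tuplets x +_) (tupletsV-insertAt xs j T)) (swap (tuplets x) (tuplets T) _)
  where swap : ∀ a b c → a + (b + c) ≡ b + (a + c)
        swap = solve-∀

tupletsL-++ : ∀ {d} (xs ys : List (Vec (Tree d) d)) →
              tupletsL (xs List.++ ys) ≡ tupletsL xs + tupletsL ys
tupletsL-++ []       ys = refl
tupletsL-++ (x ∷ xs) ys = trans (cong (tupletsV x +_) (tupletsL-++ xs ys)) (sym (+-assoc (tupletsV x) _ _))

tuplets-node-++ : ∀ {d} (xs ys : List (Vec (Tree d) d)) →
                  tuplets (node (xs List.++ ys)) ≡ tuplets (node xs) + tuplets (node ys)
tuplets-node-++ xs ys rewrite length-++ xs {ys} | tupletsL-++ xs ys =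
  interchange (length xs) (length ys) (tupletsL xs) (tupletsL ys)
  where interchange : ∀ a b c e → a + b + (c + e) ≡ a + c + (b + e)
        interchange = solve-∀

-- (tuplets, outdegree of the marked vertex, level of the marked vertex)
Stats : Set
Stats = ℕ × ℕ × ℕ

uip-Stats : UIP Stats
uip-Stats = Decidable⇒UIP.≡-irrelevant (Product.≡-dec _≟_ (Product.≡-dec _≟_ _≟_))

bareRoot : ℕ → Stats
bareRoot m = m , 0 , 0

growRoot : Stats → Stats
growRoot (m , k , ℓ) = suc m , suc k , ℓ

lowerVertex : Stats → Stats
lowerVertex (m , k , ℓ) = suc m , k , suc ℓ

bareRoot-injective : Injective _≡_ _≡_ bareRoot
bareRoot-injective refl = refl

growRoot-injective : Injective _≡_ _≡_ growRoot
growRoot-injective {_ , _ , _} {_ , _ , _} refl = refl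

lowerVertex-injective : Injective _≡_ _≡_ lowerVertex
lowerVertex-injective {_ , _ , _} {_ , _ , _} refl = refl

module Decomposition (d-1 : ℕ) where

  d : ℕ
  d = suc d-1

  open Counts d

  Forest : ℕ → ℕ → Set
  Forest r m = Fibre (tupletsV {d} {r}) m

  detachFirst : ∀ {r} → Vec (Tree d) (suc r) → Vec (Tree d) r ⊎ Vec (Tree d) (d + suc r)
  detachFirst (node []       ∷ fs) = inj₁ fs
  detachFirst (node (t ∷ ts) ∷ fs) = inj₂ (t ++ node ts ∷ fs)

  graft : ∀ {r} → Vec (Tree d) d → Vec (Tree d) (suc r) → Vec (Tree d) (suc r)
  graft t (node ts ∷ fs) = node (t ∷ ts) ∷ fs

  attachFirst : ∀ {r} → Vec (Tree d) r ⊎ Vec (Tree d) (d + suc r) → Vec (Tree d) (suc r)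
  attachFirst (inj₁ fs) = node [] ∷ fs
  attachFirst (inj₂ v)  = graft (take d v) (drop d v)

  forest-↔ : ∀ {r} → Vec (Tree d) (suc r) ↔ (Vec (Tree d) r ⊎ Vec (Tree d) (d + suc r))
  forest-↔ = mk↔ₛ′ detachFirst attachFirst detach∘attach attach∘detach
    where
    detach∘graft : ∀ {r} t (fs : Vec (Tree d) (suc r)) → detachFirst (graft t fs) ≡ inj₂ (t ++ fs)
    detach∘graft t (node ts ∷ fs) = refl
    detach∘attach : ∀ {r} (x : Vec (Tree d) r ⊎ Vec (Tree d) (d + suc r)) → detachFirst (attachFirst x) ≡ x
    detach∘attach (inj₁ fs) = refl
    detach∘attach (inj₂ v)  = trans (detach∘graft (take d v) (drop d v)) (cong inj₂ (take++drop≡id d v))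
    attach∘detach : ∀ {r} (fs : Vec (Tree d) (suc r)) → attachFirst (detachFirst fs) ≡ fs
    attach∘detach (node []       ∷ fs) = refl
    attach∘detach (node (t ∷ ts) ∷ fs) = cong (λ (t′ , fs′) → graft t′ fs′) (take-drop-++ t (node ts ∷ fs))

  tupletsV-detachFirst : ∀ {r} (fs : Vec (Tree d) (suc r)) →
                         tupletsV fs ≡ [ tupletsV , suc ∘ tupletsV ] (detachFirst fs)
  tupletsV-detachFirst (node []       ∷ fs) = refl
  tupletsV-detachFirst (node (t ∷ ts) ∷ fs) = begin
    suc (length ts) + (tupletsV t + tupletsL ts) + tupletsV fs
      ≡⟨ regroup (length ts) (tupletsV t) (tupletsL ts) (tupletsV fs) ⟩
    suc (tupletsV t + (length ts + tupletsL ts + tupletsV fs))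
      ≡⟨ cong suc (tupletsV-++ t (node ts ∷ fs)) ⟨
    suc (tupletsV (t ++ node ts ∷ fs))
      ∎
    where
    open ≡-Reasoning
    regroup : ∀ a b c e → suc a + (b + c) + e ≡ suc (b + (a + c + e))
    regroup = solve-∀

  forest-fibre : ∀ {r m} → Forest (suc r) m ↔ (Forest r m ⊎ Fibre (suc ∘ tupletsV {d} {d + suc r}) m)
  forest-fibre = ↔-trans (fibre-↔ forest-↔ tupletsV-detachFirst) fibre-⊎

  forest-count : ∀ r m → Forest r m ↔ Fin (forests r m)
  forest-count zero    zero    =
    mk↔ₛ′ (λ _ → zero) (λ _ → [] , refl) (λ { zero → refl })
          (λ { ([] , p) → cong ([] ,_) (≡-irrelevant refl p) })
  forest-count zero    (suc m) = ↔-empty (λ { ([] , ()) }) (λ ())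
  forest-count (suc r) zero    =
    ↔-trans forest-fibre (↔-trans (⊎-cong (forest-count r 0) (fibre-empty λ _ ())) (⊎-identityʳ _ _))
  forest-count (suc r) (suc m) =
    ↔-trans forest-fibre (↔-trans (⊎-cong (forest-count r (suc m)) grafted) (↔-sym +↔⊎))
    where
    grafted : Fibre (suc ∘ tupletsV {d} {d + suc r}) (suc m) ↔ Fin (forests (d + suc r) m)
    grafted = ↔-trans (fibre-injective ≡-irrelevant ≡-irrelevant suc-injective) (forest-count (d + suc r) m)

  Rooted : ℕ → Set
  Rooted r = List (Vec (Tree d) d) × Vec (Tree d) r

  rootedStats : ∀ {r} → Rooted r → Stats
  rootedStats (ts , fs) = tuplets (node ts) + tupletsV fs , length ts , 0

  detachRootTuplet : ∀ {r} → Rooted r → Vec (Tree d) r ⊎ Rooted (d + r)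
  detachRootTuplet ([]     , fs) = inj₁ fs
  detachRootTuplet (t ∷ ts , fs) = inj₂ (ts , t ++ fs)

  attachRootTuplet : ∀ {r} → Vec (Tree d) r ⊎ Rooted (d + r) → Rooted r
  attachRootTuplet (inj₁ fs)       = [] , fs
  attachRootTuplet (inj₂ (ts , v)) = take d v ∷ ts , drop d v

  rooted-↔ : ∀ {r} → Rooted r ↔ (Vec (Tree d) r ⊎ Rooted (d + r))
  rooted-↔ = mk↔ₛ′ detachRootTuplet attachRootTuplet detach∘attach attach∘detach
    where
    detach∘attach : ∀ {r} (x : Vec (Tree d) r ⊎ Rooted (d + r)) → detachRootTuplet (attachRootTuplet x) ≡ x
    detach∘attach (inj₁ fs)       = refl
    detach∘attach (inj₂ (ts , v)) = cong (λ v′ → inj₂ (ts , v′)) (take++drop≡id d v)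
    attach∘detach : ∀ {r} (x : Rooted r) → attachRootTuplet (detachRootTuplet x) ≡ x
    attach∘detach ([]     , fs) = refl
    attach∘detach (t ∷ ts , fs) = cong (λ (t′ , fs′) → t′ ∷ ts , fs′) (take-drop-++ t fs)

  rootedStats-detachRootTuplet : ∀ {r} (x : Rooted r) →
    rootedStats x ≡ [ bareRoot ∘ tupletsV , growRoot ∘ rootedStats ] (detachRootTuplet x)
  rootedStats-detachRootTuplet ([]     , fs) = refl
  rootedStats-detachRootTuplet (t ∷ ts , fs) = cong (λ m → m , suc (length ts) , 0) (begin
    suc (length ts) + (tupletsV t + tupletsL ts) + tupletsV fs
      ≡⟨ regroup (length ts) (tupletsV t) (tupletsL ts) (tupletsV fs) ⟩
    suc (length ts + tupletsL ts + (tupletsV t + tupletsV fs))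
      ≡⟨ cong (λ n → suc (length ts + tupletsL ts + n)) (tupletsV-++ t fs) ⟨
    suc (length ts + tupletsL ts + tupletsV (t ++ fs))
      ∎)
    where
    open ≡-Reasoning
    regroup : ∀ a b c e → suc a + (b + c) + e ≡ suc (a + c + (b + e))
    regroup = solve-∀

  rooted-fibre : ∀ {r s} → Fibre (rootedStats {r}) s ↔
                 (Fibre (bareRoot ∘ tupletsV {d} {r}) s ⊎ Fibre (growRoot ∘ rootedStats {d + r}) s)
  rooted-fibre = ↔-trans (fibre-↔ rooted-↔ rootedStats-detachRootTuplet) fibre-⊎

  rooted-count : ∀ r m k → Fibre (rootedStats {r}) (m , k , 0) ↔ Fin (rooted r m k)
  rooted-count r m       zero    =
    ↔-trans rooted-fibre (↔-trans (⊎-cong bare (fibre-empty λ _ ())) (⊎-identityʳ _ _))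
    where
    bare : Fibre (bareRoot ∘ tupletsV {d} {r}) (m , 0 , 0) ↔ Fin (forests r m)
    bare = ↔-trans (fibre-injective ≡-irrelevant uip-Stats bareRoot-injective) (forest-count r m)
  rooted-count r zero    (suc k) =
    ↔-trans rooted-fibre (↔-empty [ (λ { (_ , ()) }) , (λ { (_ , ()) }) ] λ ())
  rooted-count r (suc m) (suc k) =
    ↔-trans rooted-fibre (↔-trans (⊎-cong (fibre-empty λ _ ()) grown) (⊎-identityˡ _ _))
    where
    grown : Fibre (growRoot ∘ rootedStats {d + r}) (suc m , suc k , 0) ↔ Fin (rooted (d + r) m k)
    grown = ↔-trans (fibre-injective uip-Stats uip-Stats growRoot-injective) (rooted-count (d + r) m k)

  Pointed : ℕ → Set
  Pointed r = Σ (Tree d) Vertex × Vec (Tree d) r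

  pointedStats : ∀ {r} → Pointed r → Stats
  pointedStats ((T , v) , fs) = tuplets T + tupletsV fs , outdeg v , level v

  VertexInTuplet : Vec (Tree d) d → Set
  VertexInTuplet t = Σ (Fin d) λ j → Vertex (Vec.lookup t j)

  module L = Focus VertexInTuplet
  module V = Focus (Vertex {d})

  Below : ℕ → Set
  Below r = L.ListFocus × Vec (Tree d) r

  belowStats : ∀ {r} → Below r → Stats
  belowStats ((ts , i , j , v) , fs) = tuplets (node ts) + tupletsV fs , outdeg v , suc (level v)

  splitVertex : ∀ {r} → Pointed r → Rooted r ⊎ Below r
  splitVertex ((node ts , root)        , fs) = inj₁ (ts , fs)
  splitVertex ((node ts , below i j v) , fs) = inj₂ ((ts , i , j , v) , fs)

  joinVertex : ∀ {r} → Rooted r ⊎ Below r → Pointed r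
  joinVertex (inj₁ (ts , fs))               = (node ts , root) , fs
  joinVertex (inj₂ ((ts , i , j , v) , fs)) = (node ts , below i j v) , fs

  pointed-↔ : ∀ {r} → Pointed r ↔ (Rooted r ⊎ Below r)
  pointed-↔ = mk↔ₛ′ splitVertex joinVertex split∘join join∘split
    where
    split∘join : ∀ {r} (x : Rooted r ⊎ Below r) → splitVertex (joinVertex x) ≡ x
    split∘join (inj₁ _) = refl
    split∘join (inj₂ _) = refl
    join∘split : ∀ {r} (x : Pointed r) → joinVertex (splitVertex x) ≡ x
    join∘split ((node ts , root)        , fs) = refl
    join∘split ((node ts , below i j v) , fs) = refl

  pointedStats-splitVertex : ∀ {r} (x : Pointed r) →
                             pointedStats x ≡ [ rootedStats , belowStats ] (splitVertex x)
  pointedStats-splitVertex ((node ts , root)        , fs) = refl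
  pointedStats-splitVertex ((node ts , below i j v) , fs) = refl

  -- The tuplets before and after the cut one, the position j of the marked subtree in it,
  -- its d − 1 siblings, the marked subtree, and the r further trees.
  Pieces : ℕ → Set
  Pieces r = (List (Vec (Tree d) d) × List (Vec (Tree d) d) × Fin d × Vec (Tree d) d-1 × Σ (Tree d) Vertex)
             × Vec (Tree d) r

  unpack : ∀ {r} → Fin d × Pointed (suc (d + r)) → Pieces r
  unpack (j , pT , node bs ∷ node as ∷ rest) = (bs , as , j , take d-1 rest , pT) , drop d-1 rest

  pack : ∀ {r} → Pieces r → Fin d × Pointed (suc (d + r))
  pack ((bs , as , j , s , pT) , fs) = j , pT , node bs ∷ node as ∷ (s ++ fs)

  pack-↔ : ∀ {r} → (Fin d × Pointed (suc (d + r))) ↔ Pieces r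
  pack-↔ = mk↔ₛ′ unpack pack unpack∘pack pack∘unpack
    where
    unpack∘pack : ∀ {r} (x : Pieces r) → unpack (pack x) ≡ x
    unpack∘pack ((bs , as , j , s , pT) , fs) =
      cong (λ (s′ , fs′) → (bs , as , j , s′ , pT) , fs′) (take-drop-++ s fs)
    pack∘unpack : ∀ {r} (x : Fin d × Pointed (suc (d + r))) → pack (unpack x) ≡ x
    pack∘unpack (j , pT , node bs ∷ node as ∷ rest) =
      cong (λ rest′ → j , pT , node bs ∷ node as ∷ rest′) (take++drop≡id d-1 rest)

  cut-↔ : ∀ {r} → (Fin d × Pointed (suc (d + r))) ↔ Below r
  cut-↔ = ↔-trans pack-↔ (×-cong plug ↔-refl)
    where
    plug : (List (Vec (Tree d) d) × List (Vec (Tree d) d) × Fin d × Vec (Tree d) d-1 × Σ (Tree d) Vertex)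
           ↔ L.ListFocus
    plug = ↔-trans (×-cong ↔-refl (×-cong ↔-refl V.plugVec-↔)) L.plugList-↔

  belowStats-cut : ∀ {r} (x : Fin d × Pointed (suc (d + r))) →
                   lowerVertex (pointedStats (proj₂ x)) ≡ belowStats (Inverse.to cut-↔ x)
  belowStats-cut (j , (T , v) , node bs ∷ node as ∷ rest) =
    cong₂ _,_ (sym tuplets-eq) (cong₂ _,_ (sym (focus outdeg)) (cong suc (sym (focus level))))
    where
    open ≡-Reasoning
    s : Vec (Tree d) d-1
    s = take d-1 rest
    f : Vec (Tree d) _
    f = drop d-1 rest
    W : V.VecFocus d-1
    W = V.plugVec (j , s , (T , v))
    Z : L.ListFocus
    Z = L.plugList (bs , as , W)
    focus : {S : Set} (φ : ∀ {T} → Vertex T → S) → φ (proj₂ (proj₂ (proj₂ Z))) ≡ φ v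
    focus φ = trans (L.plugList-focus (φ ∘ proj₂) bs as (proj₁ W) (proj₂ W)) (V.plugVec-focus φ j s T v)
    tuplets-eq : tuplets (node (proj₁ Z)) + tupletsV f ≡ suc (tuplets T + tupletsV (node bs ∷ node as ∷ rest))
    tuplets-eq = begin
      tuplets (node (proj₁ Z)) + tupletsV f
        ≡⟨ cong (λ ts → tuplets (node ts) + tupletsV f)
                (trans (L.plugList-list bs as (proj₁ W) (proj₂ W))
                       (cong (λ t → bs List.++ t ∷ as) (V.plugVec-vec j s T v))) ⟩
      tuplets (node (bs List.++ insertAt s j T ∷ as)) + tupletsV f
        ≡⟨ cong (_+ tupletsV f) (tuplets-node-++ bs (insertAt s j T ∷ as)) ⟩
      tuplets (node bs) + (suc (length as) + (tupletsV (insertAt s j T) + tupletsL as)) + tupletsV f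
        ≡⟨ cong (λ n → tuplets (node bs) + (suc (length as) + (n + tupletsL as)) + tupletsV f)
                (tupletsV-insertAt s j T) ⟩
      tuplets (node bs) + (suc (length as) + (tuplets T + tupletsV s + tupletsL as)) + tupletsV f
        ≡⟨ regroup (tuplets (node bs)) (length as) (tupletsL as) (tuplets T) (tupletsV s) (tupletsV f) ⟩
      suc (tuplets T + (tuplets (node bs) + (tuplets (node as) + (tupletsV s + tupletsV f))))
        ≡⟨ cong (λ n → suc (tuplets T + (tuplets (node bs) + (tuplets (node as) + n)))) (tupletsV-++ s f) ⟨
      suc (tuplets T + (tuplets (node bs) + (tuplets (node as) + tupletsV (s ++ f))))
        ≡⟨ cong (λ fs → suc (tuplets T + (tuplets (node bs) + (tuplets (node as) + tupletsV fs))))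
                (take++drop≡id d-1 rest) ⟩
      suc (tuplets T + tupletsV (node bs ∷ node as ∷ rest))
        ∎
      where
      regroup : ∀ b la ta t s f → b + (suc la + (t + s + ta)) + f ≡ suc (t + (b + (la + ta + (s + f))))
      regroup = solve-∀

  pointed-fibre : ∀ {r s} → Fibre (pointedStats {r}) s ↔
                  (Fibre (rootedStats {r}) s ⊎ Fibre (lowerVertex ∘ pointedStats ∘ proj₂ {A = Fin d}) s)
  pointed-fibre =
    ↔-trans (fibre-↔ pointed-↔ pointedStats-splitVertex)
            (↔-trans fibre-⊎ (⊎-cong ↔-refl (↔-sym (fibre-↔ cut-↔ belowStats-cut))))

  pointed-count : ∀ r m k ℓ → Fibre (pointedStats {r}) (m , k , ℓ) ↔ Fin (pointed r m k ℓ)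
  pointed-count r m       k zero    =
    ↔-trans pointed-fibre (↔-trans (⊎-cong (rooted-count r m k) (fibre-empty λ _ ())) (⊎-identityʳ _ _))
  pointed-count r zero    k (suc ℓ) =
    ↔-trans pointed-fibre (↔-empty [ (λ { (_ , ()) }) , (λ { (_ , ()) }) ] λ ())
  pointed-count r (suc m) k (suc ℓ) =
    ↔-trans pointed-fibre (↔-trans (⊎-cong (fibre-empty λ _ ()) lowered) (⊎-identityˡ _ _))
    where
    lowered : Fibre (lowerVertex ∘ pointedStats ∘ proj₂ {A = Fin d}) (suc m , k , suc ℓ) ↔
              Fin (d * pointed (suc (d + r)) m k ℓ)
    lowered =
      ↔-trans (fibre-injective uip-Stats uip-Stats lowerVertex-injective)
              (↔-trans fibre-× (↔-trans (×-cong ↔-refl (pointed-count (suc (d + r)) m k ℓ)) (↔-sym *↔×)))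

  pairs-↔ : ∀ {n k ℓ} → Pairs d n k ℓ ↔ Fibre (pointedStats {0}) (n , k , ℓ)
  pairs-↔ = mk↔ₛ′ to from to∘from from∘to
    where
    to : ∀ {n k ℓ} → Pairs d n k ℓ → Fibre (pointedStats {0}) (n , k , ℓ)
    to (T , p , v , q , q′) = ((T , v) , []) , cong₂ _,_ (trans (+-identityʳ _) p) (cong₂ _,_ q q′)
    from : ∀ {n k ℓ} → Fibre (pointedStats {0}) (n , k , ℓ) → Pairs d n k ℓ
    from (((T , v) , []) , eq) =
      T , trans (sym (+-identityʳ _)) (cong proj₁ eq) , v , cong (proj₁ ∘ proj₂) eq , cong (proj₂ ∘ proj₂) eq
    to∘from : ∀ {n k ℓ} (x : Fibre (pointedStats {0}) (n , k , ℓ)) → to (from x) ≡ x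
    to∘from ((pT , []) , eq) = cong ((pT , []) ,_) (uip-Stats _ _)
    from∘to : ∀ {n k ℓ} (x : Pairs d n k ℓ) → from (to x) ≡ x
    from∘to (T , p , v , q , q′) =
      cong (λ (p′ , q₁ , q₂) → T , p′ , v , q₁ , q₂)
           (cong₂ _,_ (≡-irrelevant _ _) (cong₂ _,_ (≡-irrelevant _ _) (≡-irrelevant _ _)))

corollary4p1 : (d n k ℓ : ℕ) → 1 ≤ d → 1 ≤ n →
    Σ ℕ λ N → (Fin N ↔ Pairs d n k ℓ) ×
      (N * ((d + 1) * n ∸ k) ≡ d ^ ℓ * (d * k + (d + 1) * ℓ) * (((d + 1) * n ∸ k) C (d * n + ℓ)))
corollary4p1 zero      n k ℓ () _
corollary4p1 (suc d-1) n k ℓ d≥1 n≥1 =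
  pointed 0 n k ℓ ,
  ↔-sym (↔-trans pairs-↔ (pointed-count 0 n k ℓ)) ,
  pointed-closed d≥1 0 n k ℓ (≤-trans n≥1 (m≤m+n n 0))
  where
  open Counts (suc d-1)
  open Decomposition d-1
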